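{- Let $n\ge 3$ be an integer and let $A$ be an $n\times n$ matrix with entries in $\{0,1\}$ of the form $$A=\begin{pmatrix} O_r & X & Z\\ 0 & P & Y\\ 0 & 0 & O_s\end{pmatrix},$$ where $r\ge 0$, $s\ge 0$, $O_m$ denotes the $m\times m$ zero matrix (a block of order $0$ is vacuous), $P$ is a permutation matrix of order $n-r-s$, and $X,Y,Z$ are $0$-$1$ matrices of the appropriate sizes. If $A^2$ has all entries in $\{0,1\}$, then $f(A)\le\gamma(n)$, with equality if and only if one of the following holds: (a) $r=(n-1)/2$ when $n$ is odd and $r\in\{n/2,\,n/2-1\}$ when $n$ is even; all entries of $X$ and of $Z$ equal $1$; and each column of $Y$ has exactly one nonzero entry; (b) $s=(n-1)/2$ when $n$ is odd and $s\in\{n/2,\,n/2-1\}$ when $n$ is even; all entries of $Y$ and of $Z$ equal $1$; and each row of $X$ has exactly one nonzero entry.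
   Context: For a $0$-$1$ matrix $A$, $f(A)$ denotes the number of nonzero entries of $A$. For a positive integer $n$, $\gamma(n)=(n+1)^2/4$ if $n$ is odd and $\gamma(n)=(n^2+2n)/4$ if $n$ is even. -}

module Defs where

open import Data.Nat using (ℕ; zero; suc; _+_; _*_; _∸_; _≤_; _<_)
open import Data.Nat.DivMod using (_/_; _%_)
open import Data.Bool using (Bool; true; false; if_then_else_; _∧_)
open import Data.Fin using (Fin; toℕ)
open import Data.List using (List; map; allFin)
open import Data.Nat.ListAction using (sum)
open import Data.Product using (Σ; ∃; _×_)
open import Data.Sum using (_⊎_)
open import Relation.Binary.PropositionalEquality using (_≡_)

-- n × n 0-1 matrices: entry true = 1, false = 0.
Matrix : ℕ → Set
Matrix n = Fin n → Fin n → Bool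

val : Bool → ℕ
val b = if b then 1 else 0

∑ : ∀ {n} → (Fin n → ℕ) → ℕ
∑ {n} f = sum (map f (allFin n))

-- (i,j) entry of A² computed over ℕ
sq : ∀ {n} → Matrix n → Fin n → Fin n → ℕ
sq A i j = ∑ (λ k → val (A i k ∧ A k j))

f : ∀ {n} → Matrix n → ℕ
f A = ∑ (λ i → ∑ (λ j → val (A i j)))

γ : ℕ → ℕ
γ n with n % 2
... | zero = (n * n + 2 * n) / 4
... | suc _ = ((n + 1) * (n + 1)) / 4

ExactlyOne : ∀ {n} → (Fin n → Set) → Set
ExactlyOne {n} P = Σ (Fin n) λ j → P j × (∀ k → P k → k ≡ j)

InFirst : ∀ {n} → ℕ → Fin n → Set
InFirst r i = toℕ i < r

InMid : ∀ {n} → ℕ → ℕ → Fin n → Set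
InMid {n} r s i = r ≤ toℕ i × toℕ i < n ∸ s

InLast : ∀ {n} → ℕ → Fin n → Set
InLast {n} s i = n ∸ s ≤ toℕ i

MidIsPermutation : ∀ {n} → ℕ → ℕ → Matrix n → Set
MidIsPermutation r s A =
  (∀ i → InMid r s i → ExactlyOne (λ j → InMid r s j × A i j ≡ true)) ×
  (∀ j → InMid r s j → ExactlyOne (λ i → InMid r s i × A i j ≡ true))

BlockForm : (n r s : ℕ) → Matrix n → Set
BlockForm n r s A =
  r + s ≤ n ×
  (∀ i j → InFirst r j → A i j ≡ false) ×          -- first block column is zero (O_r, 0, 0)
  (∀ i j → InLast s i → A i j ≡ false) ×           -- last block row is zero (0, 0, O_s)
  MidIsPermutation r s A

SizeCond : ℕ → ℕ → Set
SizeCond n r =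
  (n % 2 ≡ 1 × r ≡ (n ∸ 1) / 2) ⊎
  (n % 2 ≡ 0 × (r ≡ n / 2 ⊎ r ≡ n / 2 ∸ 1))

CondA : (n r s : ℕ) → Matrix n → Set
CondA n r s A =
  SizeCond n r ×
  (∀ i j → InFirst r i → InMid r s j → A i j ≡ true) ×
  (∀ i j → InFirst r i → InLast s j → A i j ≡ true) ×
  (∀ j → InLast s j → ExactlyOne (λ i → InMid r s i × A i j ≡ true))

CondB : (n r s : ℕ) → Matrix n → Set
CondB n r s A =
  SizeCond n s ×
  (∀ i j → InMid r s i → InLast s j → A i j ≡ true) ×
  (∀ i j → InFirst r i → InLast s j → A i j ≡ true) ×
  (∀ i → InFirst r i → ExactlyOne (λ j → InMid r s j × A i j ≡ true))

module Submission where

-- Let x_k, y_k count the ones in column k of X and row k of Y.  By rows,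
-- f(A) = f(X) + f(Z) + m + f(Y).  As A² is 0-1, f(Z) ≤ rs and T = Σ_k x_k y_k (the paths
-- first block → middle → last block) is ≤ rs.  For c = max(r,s), d = min(r,s), the identity
-- c(x + y) + (c − x)(c − y) = c² + xy gives c(f(X) + f(Y)) ≤ c²m + T, whence
-- f(A) ≤ (c + 1)(m + d) ≤ γ(n), a product of two numbers summing to n + 1.  At equality all
-- steps are tight: c obeys the size condition, Z is full, each corner pair has one path
-- through the middle, and every middle k has x_k = c or y_k = c.  This makes X or Y full,
-- and the paths give the one-per-column (row) condition; for r = s a mix of both kinds
-- would need three middle indices, but the size condition forces m ≤ 2.

open import Defs
open import Data.Nat
open import Data.Nat.Properties
open import Data.Nat.DivMod using (_/_; _%_; m*n/n≡m; m*n%n≡0; [m+kn]%n≡m%n)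
import Data.Nat.ListAction as List
open import Data.Nat.Tactic.RingSolver using (solve-∀)
open import Data.Bool using (Bool; true; false; _∧_)
open import Data.Fin using (Fin; zero; suc; toℕ)
open import Data.Fin.Properties using () renaming (suc-injective to fsuc-injective; _≟_ to _≟ᶠ_)
open import Data.List using (tabulate)
open import Data.List.Properties using (map-tabulate)
open import Data.Vec.Functional using (tail)
open import Data.Product using (∃; _×_; _,_; proj₁; proj₂)
open import Data.Sum using (_⊎_; inj₁; inj₂; [_,_]) renaming (map to ⊎-map)
open import Data.Empty using (⊥; ⊥-elim)
open import Function using (id; _∘_)
open import Function.Bundles using (_⇔_; mk⇔; Equivalence)
open import Function.Construct.Composition using (_⇔-∘_)
open import Function.Construct.Symmetry using (⇔-sym)
open import Level using (0ℓ)
open import Relation.Nullary using (¬_; Dec; yes; no; contradiction)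
open import Relation.Nullary.Decidable using (_×-dec_)
open import Relation.Unary using (Pred; Decidable)
open import Relation.Binary.Definitions using (tri<; tri≈; tri>)
open import Relation.Binary.PropositionalEquality hiding ([_])
open import Algebra.Properties.CommutativeSemigroup *-commutativeSemigroup using (x∙yz≈y∙xz)
open import Algebra.Properties.Semiring.Sum +-*-semiring
  using (sum; sum-cong-≗; sum-replicate-zero; *-distribˡ-sum; *-distribʳ-sum; ∑-distrib-+; ∑-comm)

data EvenOdd : ℕ → Set where
  even : ∀ t → EvenOdd (t + t)
  odd  : ∀ t → EvenOdd (suc (t + t))

evenOdd : ∀ n → EvenOdd n
evenOdd zero = even 0
evenOdd (suc n) with evenOdd n
... | even t = odd t
... | odd t = subst EvenOdd (cong suc (+-suc t t)) (even (suc t))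

private
  double : ∀ t → t + t ≡ t * 2
  double = solve-∀

even%2 : ∀ t → (t + t) % 2 ≡ 0
even%2 t rewrite double t = m*n%n≡0 t 2

odd%2 : ∀ t → suc (t + t) % 2 ≡ 1
odd%2 t rewrite double t = [m+kn]%n≡m%n 1 t 2

half : ∀ t → (t + t) / 2 ≡ t
half t rewrite double t = m*n/n≡m t 2

-- Closed forms of γ: γ(2t) = t(t + 1) and γ(2t + 1) = (t + 1)², both in the shape u(u + e).
γ-even : ∀ t → γ (t + t) ≡ t * (t + 1)
γ-even t with (t + t) % 2 | even%2 t
... | zero | _ = trans (cong (_/ 4) (quadruple t)) (m*n/n≡m (t * (t + 1)) 4)
  where
  quadruple : ∀ t → (t + t) * (t + t) + 2 * (t + t) ≡ t * (t + 1) * 4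
  quadruple = solve-∀

γ-odd : ∀ t → γ (suc (t + t)) ≡ suc t * (suc t + 0)
γ-odd t with suc (t + t) % 2 | odd%2 t
... | suc _ | _ = trans (cong (_/ 4) (quadruple t)) (m*n/n≡m (suc t * (suc t + 0)) 4)
  where
  quadruple : ∀ t → (suc (t + t) + 1) * (suc (t + t) + 1) ≡ suc t * (suc t + 0) * 4
  quadruple = solve-∀

sizeCond-even : ∀ t r → SizeCond (t + t) r ⇔ (r ≡ t ⊎ r ≡ t ∸ 1)
sizeCond-even t r = mk⇔ to from
  where
  to : SizeCond (t + t) r → r ≡ t ⊎ r ≡ t ∸ 1
  to (inj₁ (is-odd , _)) with trans (sym (even%2 t)) is-odd
  ... | ()
  to (inj₂ (_ , inj₁ r≡)) = inj₁ (trans r≡ (half t))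
  to (inj₂ (_ , inj₂ r≡)) = inj₂ (trans r≡ (cong (_∸ 1) (half t)))
  from : r ≡ t ⊎ r ≡ t ∸ 1 → SizeCond (t + t) r
  from (inj₁ r≡) = inj₂ (even%2 t , inj₁ (trans r≡ (sym (half t))))
  from (inj₂ r≡) = inj₂ (even%2 t , inj₂ (trans r≡ (cong (_∸ 1) (sym (half t)))))

sizeCond-odd : ∀ t r → SizeCond (suc (t + t)) r ⇔ r ≡ t
sizeCond-odd t r = mk⇔ to from
  where
  to : SizeCond (suc (t + t)) r → r ≡ t
  to (inj₁ (_ , r≡)) = trans r≡ (half t)
  to (inj₂ (is-even , _)) with trans (sym (odd%2 t)) is-even
  ... | ()
  from : r ≡ t → SizeCond (suc (t + t)) r
  from r≡ = inj₁ (odd%2 t , trans r≡ (sym (half t)))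

no-gap : ∀ {a u} → a ≤ u → u ∸ a ≡ 0 → a ≡ u
no-gap a≤u u∸a≡0 = ≤-antisym a≤u (m∸n≡0⇒m≤n u∸a≡0)

product-gap : ∀ a b u e → a ≤ u → a + b ≡ u + u + e →
              a * b + (u ∸ a) * (u ∸ a + e) ≡ u * (u + e)
product-gap a b u e a≤u sum≡ with u ∸ a | m+[n∸m]≡n a≤u
... | d | refl = begin
  a * b + d * (d + e)                ≡⟨ cong (λ b → a * b + d * (d + e)) b≡ ⟩
  a * (a + d + d + e) + d * (d + e)  ≡⟨ expand a d e ⟩
  (a + d) * (a + d + e)              ∎
  where
  open ≡-Reasoning
  regroup : ∀ a d e → a + d + (a + d) + e ≡ a + (a + d + d + e)
  regroup = solve-∀
  expand : ∀ a d e → a * (a + d + d + e) + d * (d + e) ≡ (a + d) * (a + d + e)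
  expand = solve-∀
  b≡ : b ≡ a + d + d + e
  b≡ = +-cancelˡ-≡ a b _ (trans sum≡ (regroup a d e))

smaller-part : ∀ a b u e → e ≤ 1 → a + b ≡ u + u + e → a ≤ u ⊎ b ≤ u
smaller-part a b u e e≤1 sum≡ with a ≤? u
... | yes a≤u = inj₁ a≤u
... | no a≰u = inj₂ (+-cancelˡ-≤ (suc u) b u (begin
  suc u + b     ≤⟨ +-monoˡ-≤ b (≰⇒> a≰u) ⟩
  a + b         ≡⟨ sum≡ ⟩
  u + u + e     ≤⟨ +-monoʳ-≤ (u + u) e≤1 ⟩
  u + u + 1     ≡⟨ +-comm (u + u) 1 ⟩
  suc u + u     ∎))
  where open ≤-Reasoning

balanced-≤ : ∀ a b u e → e ≤ 1 → a + b ≡ u + u + e → a * b ≤ u * (u + e)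
balanced-≤ a b u e e≤1 sum≡ with smaller-part a b u e e≤1 sum≡
... | inj₁ a≤u = subst (a * b ≤_) (product-gap a b u e a≤u sum≡) (m≤m+n _ _)
... | inj₂ b≤u = subst₂ _≤_ (*-comm b a) (product-gap b a u e b≤u (trans (+-comm b a) sum≡)) (m≤m+n _ _)

gap-closed : ∀ a b u e → a ≤ u → a + b ≡ u + u + e → a * b ≡ u * (u + e) → a ≡ u
gap-closed a b u e a≤u sum≡ ab≡ = no-gap a≤u d≡0
  where
  gap≡0 : (u ∸ a) * (u ∸ a + e) ≡ 0
  gap≡0 = +-cancelˡ-≡ (a * b) _ 0
    (trans (product-gap a b u e a≤u sum≡) (trans (sym ab≡) (sym (+-identityʳ _))))
  d≡0 : u ∸ a ≡ 0
  d≡0 with m*n≡0⇒m≡0∨n≡0 (u ∸ a) gap≡0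
  ... | inj₁ d≡0 = d≡0
  ... | inj₂ d+e≡0 = m+n≡0⇒m≡0 (u ∸ a) d+e≡0

balanced-≡ : ∀ a b u e → e ≤ 1 → a + b ≡ u + u + e →
             a * b ≡ u * (u + e) ⇔ (a ≡ u ⊎ a ≡ u + e)
balanced-≡ a b u e e≤1 sum≡ = mk⇔ to from
  where
  to : a * b ≡ u * (u + e) → a ≡ u ⊎ a ≡ u + e
  to ab≡ with smaller-part a b u e e≤1 sum≡
  ... | inj₁ a≤u = inj₁ (gap-closed a b u e a≤u sum≡ ab≡)
  ... | inj₂ b≤u with gap-closed b a u e b≤u (trans (+-comm b a) sum≡) (trans (*-comm b a) ab≡)
  ...   | refl = inj₂ (+-cancelʳ-≡ u a (u + e) (trans sum≡ (trans (+-assoc u u e) (+-comm u (u + e)))))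
  from : a ≡ u ⊎ a ≡ u + e → a * b ≡ u * (u + e)
  from (inj₁ refl) = cong (a *_) (+-cancelˡ-≡ a b (a + e) (trans sum≡ (+-assoc a a e)))
  from (inj₂ refl) = trans (cong ((u + e) *_) b≡u) (*-comm (u + e) u)
    where
    b≡u : b ≡ u
    b≡u = +-cancelˡ-≡ (u + e) b u (trans sum≡ (trans (+-assoc u u e) (+-comm u (u + e))))

private
  even-split : ∀ t → suc (t + t) ≡ t + t + 1
  even-split t = sym (+-comm (t + t) 1)

  odd-split : ∀ t → suc (suc (t + t)) ≡ suc t + suc t + 0
  odd-split = solve-∀

γ-bound : ∀ {n} r q → r + q ≡ n → suc r * q ≤ γ n
γ-bound {n} r q sum≡ with evenOdd n
... | even t rewrite γ-even t = balanced-≤ (suc r) q t 1 (s≤s z≤n) (trans (cong suc sum≡) (even-split t))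
... | odd t rewrite γ-odd t = balanced-≤ (suc r) q (suc t) 0 z≤n (trans (cong suc sum≡) (odd-split t))

γ-tight : ∀ {n} r q → r + q ≡ n → suc r * q ≡ γ n ⇔ SizeCond n r
γ-tight {n} r q sum≡ with evenOdd n
... | even t rewrite γ-even t =
  ⇔-sym (sizeCond-even t r) ⇔-∘ (shift t ⇔-∘ balanced)
  where
  balanced = balanced-≡ (suc r) q t 1 (s≤s z≤n) (trans (cong suc sum≡) (even-split t))
  shift : ∀ t → (suc r ≡ t ⊎ suc r ≡ t + 1) ⇔ (r ≡ t ⊎ r ≡ t ∸ 1)
  shift zero = mk⇔ (λ { (inj₂ refl) → inj₁ refl }) (λ { (inj₁ refl) → inj₂ refl ; (inj₂ refl) → inj₂ refl })
  shift (suc t) =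
    mk⇔ (λ { (inj₁ refl) → inj₂ refl ; (inj₂ e) → inj₁ (trans (suc-injective e) (+-comm t 1)) })
        (λ { (inj₁ refl) → inj₂ (+-comm 1 (suc t)) ; (inj₂ refl) → inj₁ refl })
... | odd t rewrite γ-odd t =
  ⇔-sym (sizeCond-odd t r) ⇔-∘ (collapse ⇔-∘ balanced)
  where
  balanced = balanced-≡ (suc r) q (suc t) 0 z≤n (trans (cong suc sum≡) (odd-split t))
  collapse : (suc r ≡ suc t ⊎ suc r ≡ suc t + 0) ⇔ r ≡ t
  collapse =
    mk⇔ (λ { (inj₁ e) → suc-injective e ; (inj₂ e) → suc-injective (trans e (+-identityʳ (suc t))) })
        (λ e → inj₁ (cong suc e))

sizeCond-pos : ∀ {n r} → 3 ≤ n → SizeCond n r → 1 ≤ r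
sizeCond-pos {n} {r} 3≤n cond with evenOdd n
... | even t = even-case t 3≤n (Equivalence.to (sizeCond-even t r) cond)
  where
  even-case : ∀ t → 3 ≤ t + t → r ≡ t ⊎ r ≡ t ∸ 1 → 1 ≤ r
  even-case (suc (suc t)) _ (inj₁ refl) = s≤s z≤n
  even-case (suc (suc t)) _ (inj₂ refl) = s≤s z≤n
  even-case (suc zero) (s≤s (s≤s ())) _
... | odd t = odd-case t 3≤n (Equivalence.to (sizeCond-odd t r) cond)
  where
  odd-case : ∀ t → 3 ≤ suc (t + t) → r ≡ t → 1 ≤ r
  odd-case (suc t) _ refl = s≤s z≤n
  odd-case zero (s≤s ()) _

sizeCond-wide : ∀ {n r} → SizeCond n r → n ≤ r + r + 2
sizeCond-wide {n} {r} cond with evenOdd n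
... | even t = even-case t (Equivalence.to (sizeCond-even t r) cond)
  where
  even-case : ∀ t → r ≡ t ⊎ r ≡ t ∸ 1 → t + t ≤ r + r + 2
  even-case t (inj₁ refl) = m≤m+n (t + t) 2
  even-case zero (inj₂ refl) = z≤n
  even-case (suc t) (inj₂ refl) = ≤-reflexive (shuffle t)
    where
    shuffle : ∀ t → suc t + suc t ≡ t + t + 2
    shuffle = solve-∀
... | odd t with Equivalence.to (sizeCond-odd t r) cond
...   | refl = ≤-trans (n≤1+n (suc (t + t))) (≤-reflexive (shuffle t))
  where
  shuffle : ∀ t → suc (suc (t + t)) ≡ t + t + 2
  shuffle = solve-∀

sizeCond-middle : ∀ {n r} q → SizeCond n r → r + q + r ≡ n → q ≤ 2
sizeCond-middle {n} {r} q cond sum≡ = +-cancelʳ-≤ (r + r) q 2 (begin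
  q + (r + r)  ≡⟨ shuffle r q ⟩
  r + q + r    ≡⟨ sum≡ ⟩
  n            ≤⟨ sizeCond-wide cond ⟩
  r + r + 2    ≡⟨ +-comm (r + r) 2 ⟩
  2 + (r + r)  ∎)
  where
  open ≤-Reasoning
  shuffle : ∀ r q → q + (r + r) ≡ r + q + r
  shuffle = solve-∀

+-squeeze : ∀ {a b c d} → a ≤ b → c ≤ d → a + c ≡ b + d → a ≡ b × c ≡ d
+-squeeze a≤b c≤d sum≡ with m≤n⇒m<n∨m≡n a≤b | m≤n⇒m<n∨m≡n c≤d
... | inj₂ a≡b | inj₂ c≡d = a≡b , c≡d
... | inj₁ a<b | _ = contradiction sum≡ (<⇒≢ (+-mono-<-≤ a<b c≤d))
... | inj₂ _ | inj₁ c<d = contradiction sum≡ (<⇒≢ (+-mono-≤-< a≤b c<d))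

≤-squeeze : ∀ {a b c} → a ≤ b → b ≤ c → a ≡ c → a ≡ b × b ≡ c
≤-squeeze a≤b b≤c refl = ≤-antisym a≤b b≤c , ≤-antisym b≤c a≤b

-- If z ≤ cd, t ≤ cd and c(p + q) ≤ c²m + t, then scaling by c,
--   c(p + z + (m + q)) = c(p + q) + (cz + cm) ≤ (c²m + t) + (c·cd + cm) ≤ c(c + 1)(m + d),
-- where the middle value is  budget-mid c d m t.
budget-mid : ℕ → ℕ → ℕ → ℕ → ℕ
budget-mid c d m t = c * c * m + t + (c * (c * d) + c * m)

private
  budget-regroup : ∀ c p z m q → c * (p + z + (m + q)) ≡ c * (p + q) + (c * z + c * m)
  budget-regroup = solve-∀

  budget-factor : ∀ c d m → c * c * m + c * d + (c * (c * d) + c * m) ≡ c * (suc c * (m + d))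
  budget-factor = solve-∀

budget-lower : ∀ c d m p q z t → z ≤ c * d → c * (p + q) ≤ c * c * m + t →
               c * (p + z + (m + q)) ≤ budget-mid c d m t
budget-lower c d m p q z t z≤ pq≤ = begin
  c * (p + z + (m + q))           ≡⟨ budget-regroup c p z m q ⟩
  c * (p + q) + (c * z + c * m)   ≤⟨ +-mono-≤ pq≤ (+-monoˡ-≤ (c * m) (*-monoʳ-≤ c z≤)) ⟩
  budget-mid c d m t              ∎
  where open ≤-Reasoning

budget-upper : ∀ c d m t → t ≤ c * d → budget-mid c d m t ≤ c * (suc c * (m + d))
budget-upper c d m t t≤ = begin
  budget-mid c d m t                          ≤⟨ +-monoˡ-≤ _ (+-monoʳ-≤ (c * c * m) t≤) ⟩
  c * c * m + c * d + (c * (c * d) + c * m)   ≡⟨ budget-factor c d m ⟩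
  c * (suc c * (m + d))                       ∎
  where open ≤-Reasoning

-- Dividing by c gives the bound; for c = 0 the extra hypotheses p, q ≤ mc make p = q = 0.
budget : ∀ c d m p q z t → z ≤ c * d → c * (p + q) ≤ c * c * m + t → t ≤ c * d →
         p ≤ m * c → q ≤ m * c → p + z + (m + q) ≤ suc c * (m + d)
budget zero d m p q z t z≤ _ _ p≤ q≤
  rewrite n≤0⇒n≡0 z≤ | n≤0⇒n≡0 (subst (p ≤_) (*-zeroʳ m) p≤) | n≤0⇒n≡0 (subst (q ≤_) (*-zeroʳ m) q≤) =
  subst₂ _≤_ (sym (+-identityʳ m)) (sym (+-identityʳ (m + d))) (m≤m+n m d)
budget c@(suc _) d m p q z t z≤ pq≤ t≤ _ _ =
  *-cancelˡ-≤ c (≤-trans (budget-lower c d m p q z t z≤ pq≤) (budget-upper c d m t t≤))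

budget-tight : ∀ c d m p q z t → 1 ≤ c → z ≤ c * d → c * (p + q) ≤ c * c * m + t → t ≤ c * d →
               p + z + (m + q) ≡ suc c * (m + d) →
               z ≡ c * d × c * (p + q) ≡ c * c * m + t × t ≡ c * d
budget-tight c@(suc _) d m p q z t _ z≤ pq≤ t≤ total≡ = z≡ , pq≡ , t≡
  where
  chain = ≤-squeeze (budget-lower c d m p q z t z≤ pq≤) (budget-upper c d m t t≤) (cong (c *_) total≡)
  lower-split = +-squeeze pq≤ (+-monoˡ-≤ (c * m) (*-monoʳ-≤ c z≤))
                          (trans (sym (budget-regroup c p z m q)) (proj₁ chain))
  pq≡ : c * (p + q) ≡ c * c * m + t
  pq≡ = proj₁ lower-split
  z≡ : z ≡ c * d
  z≡ = *-cancelˡ-≡ z (c * d) c (+-cancelʳ-≡ (c * m) (c * z) (c * (c * d)) (proj₂ lower-split))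
  t≡ : t ≡ c * d
  t≡ = +-cancelˡ-≡ (c * c * m) t (c * d)
         (+-cancelʳ-≡ _ _ _ (trans (proj₂ chain) (sym (budget-factor c d m))))

mixed-identity : ∀ c x y → x ≤ c → y ≤ c → c * (x + y) + (c ∸ x) * (c ∸ y) ≡ c * c + x * y
mixed-identity c x y x≤c y≤c with c ∸ x | m+[n∸m]≡n x≤c | c ∸ y | m+[n∸m]≡n y≤c
... | p | x+p≡c | q | y+q≡c = begin
  c * (x + y) + p * q                ≡⟨ cong (_+ p * q) (*-distribˡ-+ c x y) ⟩
  c * x + c * y + p * q              ≡⟨ cong₂ (λ a b → a * x + b * y + p * q) (sym y+q≡c) (sym x+p≡c) ⟩
  (y + q) * x + (x + p) * y + p * q  ≡⟨ regroup x y p q ⟩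
  (x + p) * (y + q) + x * y          ≡⟨ cong₂ (λ a b → a * b + x * y) x+p≡c y+q≡c ⟩
  c * c + x * y                      ∎
  where
  open ≡-Reasoning
  regroup : ∀ x y p q → (y + q) * x + (x + p) * y + p * q ≡ (x + p) * (y + q) + x * y
  regroup = solve-∀

mixed-≤ : ∀ c x y → x ≤ c → y ≤ c → c * (x + y) ≤ c * c + x * y
mixed-≤ c x y x≤c y≤c = subst (c * (x + y) ≤_) (mixed-identity c x y x≤c y≤c) (m≤m+n _ _)

mixed-tight : ∀ c x y → x ≤ c → y ≤ c → c * (x + y) ≡ c * c + x * y → x ≡ c ⊎ y ≡ c
mixed-tight c x y x≤c y≤c eq = ⊎-map (no-gap x≤c) (no-gap y≤c) (m*n≡0⇒m≡0∨n≡0 (c ∸ x) slack≡0)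
  where
  slack≡0 : (c ∸ x) * (c ∸ y) ≡ 0
  slack≡0 = +-cancelˡ-≡ (c * (x + y)) _ 0
    (trans (mixed-identity c x y x≤c y≤c) (trans (sym eq) (sym (+-identityʳ _))))

val≤1 : ∀ b → val b ≤ 1
val≤1 true = s≤s z≤n
val≤1 false = z≤n

val-true : ∀ {b} → val b ≡ 1 → b ≡ true
val-true {true} _ = refl

val-false : ∀ {b} → b ≡ false → val b ≡ 0
val-false refl = refl

val-∧ : ∀ b c → val (b ∧ c) ≡ val b * val c
val-∧ true c = sym (+-identityʳ (val c))
val-∧ false c = refl

val*val≢0 : ∀ b c → val b * val c ≢ 0 → val b ≡ 1 × val c ≡ 1
val*val≢0 true true _ = refl , refl
val*val≢0 true false ≢0 = contradiction refl ≢0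
val*val≢0 false c ≢0 = contradiction refl ≢0

∑≡sum : ∀ {n} (g : Fin n → ℕ) → ∑ g ≡ sum g
∑≡sum {n} g = trans (cong List.sum (map-tabulate id g)) (tabulated n g)
  where
  tabulated : ∀ n (g : Fin n → ℕ) → List.sum (tabulate g) ≡ sum g
  tabulated zero g = refl
  tabulated (suc n) g = cong (g zero +_) (tabulated n (tail g))

sum-mono : ∀ {n} {g h : Fin n → ℕ} → (∀ i → g i ≤ h i) → sum g ≤ sum h
sum-mono {zero} _ = z≤n
sum-mono {suc n} g≤h = +-mono-≤ (g≤h zero) (sum-mono (g≤h ∘ suc))

sum-tight : ∀ {n} {g h : Fin n → ℕ} → (∀ i → g i ≤ h i) → sum g ≡ sum h → ∀ i → g i ≡ h i
sum-tight {suc n} {g} {h} g≤h sums≡ = pointwise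
  where
  split : g zero ≡ h zero × sum (tail g) ≡ sum (tail h)
  split = +-squeeze (g≤h zero) (sum-mono (g≤h ∘ suc)) sums≡
  pointwise : ∀ i → g i ≡ h i
  pointwise zero = proj₁ split
  pointwise (suc i) = sum-tight (g≤h ∘ suc) (proj₂ split) i

sum-≢ : ∀ {n} {g h : Fin n → ℕ} → sum g ≢ sum h → ∃ λ i → g i ≢ h i
sum-≢ {zero} sums≢ = contradiction refl sums≢
sum-≢ {suc n} {g} {h} sums≢ with g zero ≟ h zero
... | no g₀≢h₀ = zero , g₀≢h₀
... | yes g₀≡h₀
  with sum-≢ {n} {tail g} {tail h} (λ tails≡ → sums≢ (cong₂ _+_ g₀≡h₀ tails≡))
...   | i , gᵢ≢hᵢ = suc i , gᵢ≢hᵢ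

sum-ones : ∀ n → sum {n} (λ _ → 1) ≡ n
sum-ones zero = refl
sum-ones (suc n) = cong suc (sum-ones n)

sum-zeros : ∀ {n} {g : Fin n → ℕ} → (∀ i → g i ≡ 0) → sum g ≡ 0
sum-zeros {n} g≡0 = trans (sum-cong-≗ {n} g≡0) (sum-replicate-zero n)

sum-single : ∀ {n} {g : Fin n → ℕ} j → (∀ k → k ≢ j → g k ≡ 0) → sum g ≡ g j
sum-single {suc n} {g} zero others =
  trans (cong (g zero +_) (sum-zeros (λ k → others (suc k) λ ()))) (+-identityʳ (g zero))
sum-single {suc n} (suc j) others =
  cong₂ _+_ (others zero λ ()) (sum-single j λ k k≢j → others (suc k) λ e → k≢j (fsuc-injective e))

sum-pick : ∀ {n} (g : Fin n → ℕ) i → g i ≤ sum g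
sum-pick g zero = m≤m+n _ _
sum-pick g (suc i) = ≤-trans (sum-pick (tail g) i) (m≤n+m _ _)

sum-pair : ∀ {n} (g : Fin n → ℕ) {i j} → i ≢ j → g i + g j ≤ sum g
sum-pair g {zero} {zero} i≢j = contradiction refl i≢j
sum-pair g {zero} {suc j} _ = +-monoʳ-≤ (g zero) (sum-pick (tail g) j)
sum-pair g {suc i} {zero} _ =
  subst (_≤ sum g) (+-comm (g zero) (g (suc i))) (+-monoʳ-≤ (g zero) (sum-pick (tail g) i))
sum-pair g {suc i} {suc j} i≢j =
  ≤-trans (sum-pair (tail g) (i≢j ∘ cong suc)) (m≤n+m _ _)

sum-triple : ∀ {n} (g : Fin n → ℕ) {i j k} → i ≢ j → i ≢ k → j ≢ k → g i + g j + g k ≤ sum g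
sum-triple g {zero} {zero} i≢j _ _ = contradiction refl i≢j
sum-triple g {zero} {_} {zero} _ i≢k _ = contradiction refl i≢k
sum-triple g {_} {zero} {zero} _ _ j≢k = contradiction refl j≢k
sum-triple g {zero} {suc j} {suc k} _ _ j≢k = begin
  g zero + g (suc j) + g (suc k)    ≡⟨ +-assoc (g zero) _ _ ⟩
  g zero + (g (suc j) + g (suc k))  ≤⟨ +-monoʳ-≤ (g zero) (sum-pair (tail g) (j≢k ∘ cong suc)) ⟩
  sum g                             ∎
  where open ≤-Reasoning
sum-triple g {suc i} {zero} {suc k} _ i≢k _ = begin
  g (suc i) + g zero + g (suc k)    ≡⟨ cong (_+ g (suc k)) (+-comm (g (suc i)) (g zero)) ⟩
  g zero + g (suc i) + g (suc k)    ≡⟨ +-assoc (g zero) _ _ ⟩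
  g zero + (g (suc i) + g (suc k))  ≤⟨ +-monoʳ-≤ (g zero) (sum-pair (tail g) (i≢k ∘ cong suc)) ⟩
  sum g                             ∎
  where open ≤-Reasoning
sum-triple g {suc i} {suc j} {zero} i≢j _ _ = begin
  g (suc i) + g (suc j) + g zero    ≡⟨ +-comm (g (suc i) + g (suc j)) (g zero) ⟩
  g zero + (g (suc i) + g (suc j))  ≤⟨ +-monoʳ-≤ (g zero) (sum-pair (tail g) (i≢j ∘ cong suc)) ⟩
  sum g                             ∎
  where open ≤-Reasoning
sum-triple g {suc i} {suc j} {suc k} i≢j i≢k j≢k =
  ≤-trans (sum-triple (tail g) (i≢j ∘ cong suc) (i≢k ∘ cong suc) (j≢k ∘ cong suc)) (m≤n+m _ _)

binary : ∀ {x} → x ≤ 1 → x ≡ 0 ⊎ x ≡ 1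
binary z≤n = inj₁ refl
binary (s≤s z≤n) = inj₂ refl

sum-one-iff : ∀ {n} {g : Fin n → ℕ} → (∀ i → g i ≤ 1) → sum g ≡ 1 ⇔ ExactlyOne (λ i → g i ≡ 1)
sum-one-iff {n} {g} g≤1 = mk⇔ to from
  where
  to : sum g ≡ 1 → ExactlyOne (λ i → g i ≡ 1)
  to sum≡1
    with sum-≢ {g = g} {h = λ _ → 0}
               (λ sum≡0 → 1+n≢0 (trans (sym sum≡1) (trans sum≡0 (sum-replicate-zero n))))
  ... | i , gᵢ≢0 = i , gᵢ≡1 , unique
    where
    gᵢ≡1 : g i ≡ 1
    gᵢ≡1 with binary (g≤1 i)
    ... | inj₁ gᵢ≡0 = contradiction gᵢ≡0 gᵢ≢0
    ... | inj₂ gᵢ≡1 = gᵢ≡1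
    unique : ∀ k → g k ≡ 1 → k ≡ i
    unique k gₖ≡1 with k ≟ᶠ i
    ... | yes k≡i = k≡i
    ... | no k≢i = contradiction (subst (2 ≤_) sum≡1 two≤sum) λ { (s≤s ()) }
      where
      two≤sum : 2 ≤ sum g
      two≤sum = subst₂ (λ a b → a + b ≤ sum g) gₖ≡1 gᵢ≡1 (sum-pair g k≢i)
  from : ExactlyOne (λ i → g i ≡ 1) → sum g ≡ 1
  from (j , gⱼ≡1 , unique) = trans (sum-single j off-j) gⱼ≡1
    where
    off-j : ∀ k → k ≢ j → g k ≡ 0
    off-j k k≢j with binary (g≤1 k)
    ... | inj₁ gₖ≡0 = gₖ≡0
    ... | inj₂ gₖ≡1 = contradiction (unique k gₖ≡1) k≢j

ExactlyOne-cong : ∀ {n} {P Q : Fin n → Set} → (∀ i → P i ⇔ Q i) → ExactlyOne P ⇔ ExactlyOne Q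
ExactlyOne-cong P⇔Q = mk⇔
  (λ (j , pⱼ , unique) → j , Equivalence.to (P⇔Q j) pⱼ , λ k qₖ → unique k (Equivalence.from (P⇔Q k) qₖ))
  (λ (j , qⱼ , unique) → j , Equivalence.from (P⇔Q j) qⱼ , λ k pₖ → unique k (Equivalence.to (P⇔Q k) pₖ))

𝟙 : {P : Set} → Dec P → ℕ
𝟙 (yes _) = 1
𝟙 (no _) = 0

𝟙-cong : ∀ {P Q : Set} → (P → Q) → (Q → P) → (d : Dec P) (e : Dec Q) → 𝟙 d ≡ 𝟙 e
𝟙-cong _ _ (yes _) (yes _) = refl
𝟙-cong P→Q _ (yes p) (no ¬q) = contradiction (P→Q p) ¬q
𝟙-cong _ Q→P (no ¬p) (yes q) = contradiction (Q→P q) ¬p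
𝟙-cong _ _ (no _) (no _) = refl

𝟙-yes : ∀ {P : Set} → P → (d : Dec P) → 𝟙 d ≡ 1
𝟙-yes p (yes _) = refl
𝟙-yes p (no ¬p) = contradiction p ¬p

𝟙-no : ∀ {P : Set} → ¬ P → (d : Dec P) → 𝟙 d ≡ 0
𝟙-no ¬p (yes p) = contradiction p ¬p
𝟙-no _ (no _) = refl

sum-on : ∀ {n} {P : Pred (Fin n) 0ℓ} → Decidable P → (Fin n → ℕ) → ℕ
sum-on P? g = sum (λ i → 𝟙 (P? i) * g i)

count : ∀ {n} {P : Pred (Fin n) 0ℓ} → Decidable P → ℕ
count P? = sum (λ i → 𝟙 (P? i))

module _ {P : Set} where

  𝟙-weight-drop : ∀ (d : Dec P) x → 𝟙 d * x ≤ x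
  𝟙-weight-drop (yes _) x = ≤-reflexive (*-identityˡ x)
  𝟙-weight-drop (no _) x = z≤n

  𝟙-weight-≤ : ∀ (d : Dec P) {x y} → (P → x ≤ y) → 𝟙 d * x ≤ 𝟙 d * y
  𝟙-weight-≤ (yes p) x≤y = +-monoˡ-≤ 0 (x≤y p)
  𝟙-weight-≤ (no _) _ = z≤n

  𝟙-weight-≡ : ∀ (d : Dec P) {x y} → (P → x ≡ y) → 𝟙 d * x ≡ 𝟙 d * y
  𝟙-weight-≡ (yes p) x≡y = cong (_+ 0) (x≡y p)
  𝟙-weight-≡ (no _) _ = refl

  𝟙-weight-cancel : ∀ (d : Dec P) {x y} → 𝟙 d * x ≡ 𝟙 d * y → P → x ≡ y
  𝟙-weight-cancel (yes _) {x} {y} e _ = +-cancelʳ-≡ 0 x y e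
  𝟙-weight-cancel (no ¬p) _ p = contradiction p ¬p

  𝟙-weight-≢ : ∀ (d : Dec P) {x y} → 𝟙 d * x ≢ 𝟙 d * y → P × x ≢ y
  𝟙-weight-≢ (yes p) x≢y = p , λ x≡y → x≢y (cong (_+ 0) x≡y)
  𝟙-weight-≢ (no _) x≢y = contradiction refl x≢y

  𝟙-weight-val : ∀ (d : Dec P) b → 𝟙 d * val b ≡ 1 ⇔ (P × b ≡ true)
  𝟙-weight-val (yes p) true = mk⇔ (λ _ → p , refl) (λ _ → refl)
  𝟙-weight-val (yes p) false = mk⇔ (λ ()) (λ ())
  𝟙-weight-val (no ¬p) b = mk⇔ (λ ()) (λ (p , _) → contradiction p ¬p)

module _ {n} {P : Pred (Fin n) 0ℓ} (P? : Decidable P) where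

  sum-on-mono : ∀ {g h : Fin n → ℕ} → (∀ i → P i → g i ≤ h i) → sum-on P? g ≤ sum-on P? h
  sum-on-mono g≤h = sum-mono (λ i → 𝟙-weight-≤ (P? i) (g≤h i))

  sum-on-cong : ∀ {g h : Fin n → ℕ} → (∀ i → P i → g i ≡ h i) → sum-on P? g ≡ sum-on P? h
  sum-on-cong g≡h = sum-cong-≗ {n} (λ i → 𝟙-weight-≡ (P? i) (g≡h i))

  sum-on-tight : ∀ {g h : Fin n → ℕ} → (∀ i → P i → g i ≤ h i) → sum-on P? g ≡ sum-on P? h →
                 ∀ i → P i → g i ≡ h i
  sum-on-tight g≤h sums≡ i = 𝟙-weight-cancel (P? i) (sum-tight (λ i → 𝟙-weight-≤ (P? i) (g≤h i)) sums≡ i)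

  sum-on-≢ : ∀ {g h : Fin n → ℕ} → sum-on P? g ≢ sum-on P? h → ∃ λ i → P i × g i ≢ h i
  sum-on-≢ sums≢ with sum-≢ sums≢
  ... | i , terms≢ = i , 𝟙-weight-≢ (P? i) terms≢

  sum-on-const : ∀ c → sum-on P? (λ _ → c) ≡ count P? * c
  sum-on-const c = sym (*-distribʳ-sum c (λ i → 𝟙 (P? i)))

  sum-on-full : ∀ {g : Fin n → ℕ} c → (∀ i → P i → g i ≡ c) → sum-on P? g ≡ count P? * c
  sum-on-full c g≡c = trans (sum-on-cong g≡c) (sum-on-const c)

  sum-on-zero : ∀ {g : Fin n → ℕ} → (∀ i → P i → g i ≡ 0) → sum-on P? g ≡ 0
  sum-on-zero g≡0 = trans (sum-on-full 0 g≡0) (*-zeroʳ (count P?))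

  sum-on-bound : ∀ {g : Fin n → ℕ} c → (∀ i → P i → g i ≤ c) → sum-on P? g ≤ count P? * c
  sum-on-bound c g≤c = subst (_ ≤_) (sum-on-const c) (sum-on-mono g≤c)

  sum-on-bound-tight : ∀ {g : Fin n → ℕ} c → (∀ i → P i → g i ≤ c) → sum-on P? g ≡ count P? * c →
                       ∀ i → P i → g i ≡ c
  sum-on-bound-tight c g≤c sum≡ = sum-on-tight g≤c (trans sum≡ (sym (sum-on-const c)))

  sum-on-all-or-gap : ∀ {g : Fin n → ℕ} c → (∀ i → P i → g i ≤ c) →
                      (∀ i → P i → g i ≡ c) ⊎ ∃ λ i → P i × g i ≢ c
  sum-on-all-or-gap {g} c g≤c with sum-on P? g ≟ sum-on P? (λ _ → c)
  ... | yes sums≡ = inj₁ (sum-on-tight g≤c sums≡)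
  ... | no sums≢ = inj₂ (sum-on-≢ sums≢)

  nonempty : 1 ≤ count P? → ∃ P
  nonempty 1≤count
    with sum-≢ {g = λ i → 𝟙 (P? i)} {h = λ _ → 0}
               (λ count≡0 → <⇒≢ 1≤count (sym (trans count≡0 (sum-replicate-zero n))))
  ... | i , 𝟙≢0 with P? i
  ...   | yes p = i , p
  ...   | no _ = contradiction refl 𝟙≢0

  sum-on-+ : ∀ (g h : Fin n → ℕ) → sum-on P? (λ i → g i + h i) ≡ sum-on P? g + sum-on P? h
  sum-on-+ g h = trans (sum-cong-≗ {n} (λ i → *-distribˡ-+ (𝟙 (P? i)) (g i) (h i)))
                       (∑-distrib-+ (λ i → 𝟙 (P? i) * g i) (λ i → 𝟙 (P? i) * h i))

  sum-on-*ˡ : ∀ c (g : Fin n → ℕ) → sum-on P? (λ i → c * g i) ≡ c * sum-on P? g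
  sum-on-*ˡ c g = trans (sum-cong-≗ {n} (λ i → x∙yz≈y∙xz (𝟙 (P? i)) c (g i)))
                        (sym (*-distribˡ-sum c (λ i → 𝟙 (P? i) * g i)))

  sum-on-*ʳ : ∀ c (g : Fin n → ℕ) → sum-on P? (λ i → g i * c) ≡ sum-on P? g * c
  sum-on-*ʳ c g = trans (sum-cong-≗ {n} (λ i → sym (*-assoc (𝟙 (P? i)) (g i) c)))
                        (sym (*-distribʳ-sum c (λ i → 𝟙 (P? i) * g i)))

  sum-on-one-iff : ∀ (b : Fin n → Bool) →
                   sum-on P? (λ i → val (b i)) ≡ 1 ⇔ ExactlyOne (λ i → P i × b i ≡ true)
  sum-on-one-iff b = ExactlyOne-cong (λ i → 𝟙-weight-val (P? i) (b i))
                       ⇔-∘ sum-one-iff (λ i → ≤-trans (𝟙-weight-drop (P? i) (val (b i))) (val≤1 (b i)))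

sum-on-swap : ∀ {m n} {P : Pred (Fin m) 0ℓ} {Q : Pred (Fin n) 0ℓ} (P? : Decidable P) (Q? : Decidable Q)
              (w : Fin m → Fin n → ℕ) →
              sum-on P? (λ i → sum-on Q? (λ j → w i j)) ≡ sum-on Q? (λ j → sum-on P? (λ i → w i j))
sum-on-swap {m} {n} P? Q? w = begin
  sum-on P? (λ i → sum-on Q? (λ j → w i j))
    ≡⟨ sum-cong-≗ {m} (λ i → *-distribˡ-sum (𝟙 (P? i)) (λ j → 𝟙 (Q? j) * w i j)) ⟩
  sum (λ i → sum (λ j → 𝟙 (P? i) * (𝟙 (Q? j) * w i j)))
    ≡⟨ ∑-comm (λ i j → 𝟙 (P? i) * (𝟙 (Q? j) * w i j)) ⟩
  sum (λ j → sum (λ i → 𝟙 (P? i) * (𝟙 (Q? j) * w i j)))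
    ≡⟨ sum-cong-≗ {n} (λ j → sum-cong-≗ {m} (λ i → x∙yz≈y∙xz (𝟙 (P? i)) (𝟙 (Q? j)) (w i j))) ⟩
  sum (λ j → sum (λ i → 𝟙 (Q? j) * (𝟙 (P? i) * w i j)))
    ≡⟨ sum-cong-≗ {n} (λ j → sym (*-distribˡ-sum (𝟙 (Q? j)) (λ i → 𝟙 (P? i) * w i j))) ⟩
  sum-on Q? (λ j → sum-on P? (λ i → w i j))  ∎
  where open ≡-Reasoning

count-below : ∀ n c → c ≤ n → sum (λ (i : Fin n) → 𝟙 (toℕ i <? c)) ≡ c
count-below zero zero _ = refl
count-below (suc n) zero _ = sum-zeros {suc n} (λ i → 𝟙-no (λ ()) (toℕ i <? 0))
count-below (suc n) (suc c) (s≤s c≤n) = cong suc (begin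
  sum {n} (λ i → 𝟙 (suc (toℕ i) <? suc c))
    ≡⟨ sum-cong-≗ {n} (λ i → 𝟙-cong s≤s⁻¹ s≤s (suc (toℕ i) <? suc c) (toℕ i <? c)) ⟩
  sum {n} (λ i → 𝟙 (toℕ i <? c))
    ≡⟨ count-below n c c≤n ⟩
  c ∎)
  where open ≡-Reasoning

module IndexBlocks (n r s : ℕ) (r+s≤n : r + s ≤ n) where

  first? : Decidable (InFirst {n} r)
  first? i = toℕ i <? r

  mid? : Decidable (InMid {n} r s)
  mid? i = (r ≤? toℕ i) ×-dec (toℕ i <? n ∸ s)

  last? : Decidable (InLast {n} s)
  last? i = n ∸ s ≤? toℕ i

  m : ℕ
  m = count mid?

  private
    r≤n∸s : r ≤ n ∸ s
    r≤n∸s = m+n≤o⇒m≤o∸n r r+s≤n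

    first-or-mid : ∀ (i : Fin n) →
                   𝟙 (toℕ i <? r) + 𝟙 ((r ≤? toℕ i) ×-dec (toℕ i <? n ∸ s)) ≡ 𝟙 (toℕ i <? n ∸ s)
    first-or-mid i with r ≤? toℕ i | toℕ i <? r | toℕ i <? n ∸ s
    ... | yes r≤i | yes i<r | _ = contradiction r≤i (<⇒≱ i<r)
    ... | yes _ | no _ | yes _ = refl
    ... | yes _ | no _ | no _ = refl
    ... | no _ | yes _ | yes _ = refl
    ... | no _ | yes i<r | no i≮n∸s = contradiction (<-≤-trans i<r r≤n∸s) i≮n∸s
    ... | no r≰i | no i≮r | _ = contradiction (≮⇒≥ i≮r) r≰i

    below-or-last : ∀ (i : Fin n) → 𝟙 (toℕ i <? n ∸ s) + 𝟙 (n ∸ s ≤? toℕ i) ≡ 1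
    below-or-last i with toℕ i <? n ∸ s | n ∸ s ≤? toℕ i
    ... | yes i<n∸s | yes n∸s≤i = contradiction n∸s≤i (<⇒≱ i<n∸s)
    ... | yes _ | no _ = refl
    ... | no _ | yes _ = refl
    ... | no i≮n∸s | no n∸s≰i = contradiction (≮⇒≥ i≮n∸s) n∸s≰i

  one-block : ∀ i → 𝟙 (first? i) + 𝟙 (mid? i) + 𝟙 (last? i) ≡ 1
  one-block i = trans (cong (_+ 𝟙 (last? i)) (first-or-mid i)) (below-or-last i)

  sum-partition : ∀ (g : Fin n → ℕ) → sum g ≡ sum-on first? g + sum-on mid? g + sum-on last? g
  sum-partition g = begin
    sum g
      ≡⟨ sum-cong-≗ {n} weigh ⟩
    sum (λ i → 𝟙 (first? i) * g i + 𝟙 (mid? i) * g i + 𝟙 (last? i) * g i)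
      ≡⟨ ∑-distrib-+ (λ i → 𝟙 (first? i) * g i + 𝟙 (mid? i) * g i) (λ i → 𝟙 (last? i) * g i) ⟩
    sum (λ i → 𝟙 (first? i) * g i + 𝟙 (mid? i) * g i) + sum-on last? g
      ≡⟨ cong (_+ sum-on last? g) (∑-distrib-+ (λ i → 𝟙 (first? i) * g i) (λ i → 𝟙 (mid? i) * g i)) ⟩
    sum-on first? g + sum-on mid? g + sum-on last? g ∎
    where
    open ≡-Reasoning
    weigh : ∀ i → g i ≡ 𝟙 (first? i) * g i + 𝟙 (mid? i) * g i + 𝟙 (last? i) * g i
    weigh i = begin
      g i
        ≡⟨ sym (*-identityˡ (g i)) ⟩
      1 * g i
        ≡⟨ cong (_* g i) (sym (one-block i)) ⟩
      (𝟙 (first? i) + 𝟙 (mid? i) + 𝟙 (last? i)) * g i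
        ≡⟨ *-distribʳ-+ (g i) (𝟙 (first? i) + 𝟙 (mid? i)) _ ⟩
      (𝟙 (first? i) + 𝟙 (mid? i)) * g i + 𝟙 (last? i) * g i
        ≡⟨ cong (_+ 𝟙 (last? i) * g i) (*-distribʳ-+ (g i) (𝟙 (first? i)) _) ⟩
      𝟙 (first? i) * g i + 𝟙 (mid? i) * g i + 𝟙 (last? i) * g i ∎

  count-first : count first? ≡ r
  count-first = count-below n r (≤-trans (m≤m+n r s) r+s≤n)

  private
    s≤n : s ≤ n
    s≤n = ≤-trans (m≤n+m s r) r+s≤n

    first+mid : r + m ≡ n ∸ s
    first+mid = begin
      r + m                                       ≡⟨ cong (_+ m) (sym count-first) ⟩
      count first? + count mid?                   ≡⟨ sym (∑-distrib-+ (𝟙 ∘ first?) (𝟙 ∘ mid?)) ⟩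
      sum {n} (λ i → 𝟙 (first? i) + 𝟙 (mid? i))   ≡⟨ sum-cong-≗ {n} first-or-mid ⟩
      sum {n} (λ i → 𝟙 (toℕ i <? n ∸ s))          ≡⟨ count-below n (n ∸ s) (m∸n≤m n s) ⟩
      n ∸ s                                       ∎
      where open ≡-Reasoning

    below+last : n ∸ s + count last? ≡ n
    below+last = begin
      n ∸ s + count last?
        ≡⟨ cong (_+ count last?) (sym (count-below n (n ∸ s) (m∸n≤m n s))) ⟩
      sum {n} (λ i → 𝟙 (toℕ i <? n ∸ s)) + count last?
        ≡⟨ sym (∑-distrib-+ {n} (λ i → 𝟙 (toℕ i <? n ∸ s)) (𝟙 ∘ last?)) ⟩
      sum {n} (λ i → 𝟙 (toℕ i <? n ∸ s) + 𝟙 (last? i))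
        ≡⟨ sum-cong-≗ {n} below-or-last ⟩
      sum {n} (λ _ → 1)
        ≡⟨ sum-ones n ⟩
      n ∎
      where open ≡-Reasoning

  count-last : count last? ≡ s
  count-last = +-cancelˡ-≡ (n ∸ s) (count last?) s (trans below+last (sym (m∸n+n≡m s≤n)))

  block-sizes : r + m + s ≡ n
  block-sizes = trans (cong (_+ s) first+mid) (m∸n+n≡m s≤n)

-- The counting analysis of a block-form matrix A whose square is 0-1.
module Analysis {n r s : ℕ} {A : Matrix n}
  (r+s≤n : r + s ≤ n)
  (first-column-zero : ∀ i j → InFirst r j → A i j ≡ false)
  (last-row-zero : ∀ i j → InLast s i → A i j ≡ false)
  (P-rows : ∀ i → InMid r s i → ExactlyOne (λ j → InMid r s j × A i j ≡ true))
  (square-01 : ∀ i j → sq A i j ≤ 1)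
  where

  open IndexBlocks n r s r+s≤n

  a : Fin n → Fin n → ℕ
  a i j = val (A i j)

  a≤1 : ∀ i j → a i j ≤ 1
  a≤1 i j = val≤1 (A i j)

  x : Fin n → ℕ
  x k = sum-on first? (λ i → a i k)

  y : Fin n → ℕ
  y k = sum-on last? (λ j → a k j)

  ρ κ : Fin n → ℕ
  ρ i = sum-on mid? (λ j → a i j)
  κ j = sum-on mid? (λ i → a i j)

  -- f(X), f(Y) and f(Z)
  SX SY SZ : ℕ
  SX = sum-on mid? x
  SY = sum-on mid? y
  SZ = sum-on first? y

  Q : Fin n → Fin n → ℕ
  Q i j = sum-on mid? (λ k → a i k * a k j)

  T : ℕ
  T = sum-on mid? (λ k → x k * y k)

  corner : (Fin n → Fin n → ℕ) → ℕ
  corner G = sum-on first? (λ i → sum-on last? (λ j → G i j))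

  first-≤ : ∀ {g : Fin n → ℕ} c → (∀ i → InFirst r i → g i ≤ c) → sum-on first? g ≤ r * c
  first-≤ {g} c g≤c = subst (λ t → sum-on first? g ≤ t * c) count-first (sum-on-bound first? c g≤c)

  first-tight : ∀ {g : Fin n → ℕ} c → (∀ i → InFirst r i → g i ≤ c) → sum-on first? g ≡ r * c →
                ∀ i → InFirst r i → g i ≡ c
  first-tight c g≤c sum≡ =
    sum-on-bound-tight first? c g≤c (trans sum≡ (cong (_* c) (sym count-first)))

  first-full : ∀ {g : Fin n → ℕ} c → (∀ i → InFirst r i → g i ≡ c) → sum-on first? g ≡ r * c
  first-full c g≡c = trans (sum-on-full first? c g≡c) (cong (_* c) count-first)

  last-≤ : ∀ {g : Fin n → ℕ} c → (∀ j → InLast s j → g j ≤ c) → sum-on last? g ≤ s * c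
  last-≤ {g} c g≤c = subst (λ t → sum-on last? g ≤ t * c) count-last (sum-on-bound last? c g≤c)

  last-tight : ∀ {g : Fin n → ℕ} c → (∀ j → InLast s j → g j ≤ c) → sum-on last? g ≡ s * c →
               ∀ j → InLast s j → g j ≡ c
  last-tight c g≤c sum≡ =
    sum-on-bound-tight last? c g≤c (trans sum≡ (cong (_* c) (sym count-last)))

  last-full : ∀ {g : Fin n → ℕ} c → (∀ j → InLast s j → g j ≡ c) → sum-on last? g ≡ s * c
  last-full c g≡c = trans (sum-on-full last? c g≡c) (cong (_* c) count-last)

  first-ones : ∀ {g : Fin n → ℕ} → (∀ i → InFirst r i → g i ≡ 1) → sum-on first? g ≡ r
  first-ones g≡1 = trans (first-full 1 g≡1) (*-identityʳ r)

  last-ones : ∀ {g : Fin n → ℕ} → (∀ j → InLast s j → g j ≡ 1) → sum-on last? g ≡ s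
  last-ones g≡1 = trans (last-full 1 g≡1) (*-identityʳ s)

  ρ-mid : ∀ i → InMid r s i → ρ i ≡ 1
  ρ-mid i i∈ = Equivalence.from (sum-on-one-iff mid? (A i)) (P-rows i i∈)

  row-split : ∀ i → sum (λ j → a i j) ≡ ρ i + y i
  row-split i = trans (sum-partition (λ j → a i j)) (cong (λ t → t + ρ i + y i) first-part)
    where
    first-part : sum-on first? (λ j → a i j) ≡ 0
    first-part = sum-on-zero first? (λ j j∈ → val-false (first-column-zero i j j∈))

  f-decomposition : f A ≡ SX + SZ + (m + SY)
  f-decomposition = begin
    f A
      ≡⟨ trans (∑≡sum (λ i → ∑ (a i))) (sum-cong-≗ {n} (λ i → ∑≡sum (a i))) ⟩
    sum (λ i → sum (λ j → a i j))
      ≡⟨ sum-cong-≗ {n} row-split ⟩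
    sum (λ i → ρ i + y i)
      ≡⟨ sum-partition (λ i → ρ i + y i) ⟩
    sum-on first? (λ i → ρ i + y i) + sum-on mid? (λ i → ρ i + y i) + sum-on last? (λ i → ρ i + y i)
      ≡⟨ cong₂ (λ u v → u + v + sum-on last? (λ i → ρ i + y i)) first-rows middle-rows ⟩
    SX + SZ + (m + SY) + sum-on last? (λ i → ρ i + y i)
      ≡⟨ cong (SX + SZ + (m + SY) +_) last-rows ⟩
    SX + SZ + (m + SY) + 0
      ≡⟨ +-identityʳ _ ⟩
    SX + SZ + (m + SY) ∎
    where
    open ≡-Reasoning
    first-rows : sum-on first? (λ i → ρ i + y i) ≡ SX + SZ
    first-rows = trans (sum-on-+ first? ρ y) (cong (_+ SZ) (sum-on-swap first? mid? a))
    middle-rows : sum-on mid? (λ i → ρ i + y i) ≡ m + SY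
    middle-rows = begin
      sum-on mid? (λ i → ρ i + y i)  ≡⟨ sum-on-cong mid? (λ i i∈ → cong (_+ y i) (ρ-mid i i∈)) ⟩
      sum-on mid? (λ i → 1 + y i)    ≡⟨ sum-on-+ mid? (λ _ → 1) y ⟩
      sum-on mid? (λ _ → 1) + SY     ≡⟨ cong (_+ SY) (trans (sum-on-const mid? 1) (*-identityʳ m)) ⟩
      m + SY                         ∎
    last-rows : sum-on last? (λ i → ρ i + y i) ≡ 0
    last-rows = sum-on-zero last? (λ i i∈ → cong₂ _+_
      (sum-on-zero mid? (λ j _ → val-false (last-row-zero i j i∈)))
      (sum-on-zero last? (λ j _ → val-false (last-row-zero i j i∈))))

  last-ones-≤ : ∀ (g : Fin n → ℕ) → (∀ j → g j ≤ 1) → sum-on last? g ≤ s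
  last-ones-≤ g g≤1 = ≤-trans (last-≤ 1 (λ j _ → g≤1 j)) (≤-reflexive (*-identityʳ s))

  y≤s : ∀ k → y k ≤ s
  y≤s k = last-ones-≤ (a k) (a≤1 k)

  x≤r : ∀ k → x k ≤ r
  x≤r k = ≤-trans (first-≤ 1 (λ i _ → a≤1 i k)) (≤-reflexive (*-identityʳ r))

  X-column-full : ∀ k → x k ≡ r → ∀ i → InFirst r i → A i k ≡ true
  X-column-full k x≡r i i∈ =
    val-true (first-tight 1 (λ i _ → a≤1 i k) (trans x≡r (sym (*-identityʳ r))) i i∈)

  Y-row-full : ∀ k → y k ≡ s → ∀ j → InLast s j → A k j ≡ true
  Y-row-full k y≡s j j∈ =
    val-true (last-tight 1 (λ j _ → a≤1 k j) (trans y≡s (sym (*-identityʳ s))) j j∈)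

  corner-≤ : ∀ (G : Fin n → Fin n → ℕ) → (∀ i j → G i j ≤ 1) → corner G ≤ r * s
  corner-≤ G G≤1 = first-≤ s (λ i _ → last-ones-≤ (G i) (G≤1 i))

  corner-full : ∀ (G : Fin n → Fin n → ℕ) → (∀ i j → G i j ≤ 1) → corner G ≡ r * s →
                ∀ i j → InFirst r i → InLast s j → G i j ≡ 1
  corner-full G G≤1 corner≡ i j i∈ j∈ = last-tight 1 (λ j _ → G≤1 i j) row≡ j j∈
    where
    row≡ : sum-on last? (G i) ≡ s * 1
    row≡ = trans (first-tight s (λ i _ → last-ones-≤ (G i) (G≤1 i)) corner≡ i i∈) (sym (*-identityʳ s))

  -- Paths through the middle are among the paths counted by A², hence Q ≤ 1.
  Q≤1 : ∀ i j → Q i j ≤ 1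
  Q≤1 i j = begin
    Q i j                      ≤⟨ sum-mono (λ k → 𝟙-weight-drop (mid? k) (a i k * a k j)) ⟩
    sum (λ k → a i k * a k j)  ≡⟨ sym square≡ ⟩
    sq A i j                   ≤⟨ square-01 i j ⟩
    1                          ∎
    where
    open ≤-Reasoning
    square≡ : sq A i j ≡ sum (λ k → a i k * a k j)
    square≡ = trans (∑≡sum (λ k → val (A i k ∧ A k j))) (sum-cong-≗ {n} (λ k → val-∧ (A i k) (A k j)))

  -- Counting the corner paths i → k → j by their middle vertex k gives T.
  T≡corner : T ≡ corner Q
  T≡corner = sym (begin
    corner Q
      ≡⟨ sum-on-cong first? (λ i _ → sum-on-swap last? mid? (λ j k → a i k * a k j)) ⟩
    sum-on first? (λ i → sum-on mid? (λ k → sum-on last? (λ j → a i k * a k j)))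
      ≡⟨ sum-on-swap first? mid? (λ i k → sum-on last? (λ j → a i k * a k j)) ⟩
    sum-on mid? (λ k → sum-on first? (λ i → sum-on last? (λ j → a i k * a k j)))
      ≡⟨ sum-on-cong mid? (λ k _ → sum-on-cong first? (λ i _ → sum-on-*ˡ last? (a i k) (a k))) ⟩
    sum-on mid? (λ k → sum-on first? (λ i → a i k * y k))
      ≡⟨ sum-on-cong mid? (λ k _ → sum-on-*ʳ first? (y k) (λ i → a i k)) ⟩
    T ∎)
    where open ≡-Reasoning

  private
    mixed-lhs : ∀ c → c * (SX + SY) ≡ sum-on mid? (λ k → c * (x k + y k))
    mixed-lhs c = sym (trans (sum-on-*ˡ mid? c (λ k → x k + y k)) (cong (c *_) (sum-on-+ mid? x y)))

    mixed-rhs : ∀ c → sum-on mid? (λ k → c * c + x k * y k) ≡ c * c * m + T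
    mixed-rhs c = trans (sum-on-+ mid? (λ _ → c * c) (λ k → x k * y k))
                        (cong (_+ T) (trans (sum-on-const mid? (c * c)) (*-comm m (c * c))))

    mixed-pointwise : ∀ c → r ≤ c → s ≤ c → ∀ k → InMid r s k →
                      c * (x k + y k) ≤ c * c + x k * y k
    mixed-pointwise c r≤c s≤c k _ = mixed-≤ c (x k) (y k) (≤-trans (x≤r k) r≤c) (≤-trans (y≤s k) s≤c)

  mixed-sum-≤ : ∀ c → r ≤ c → s ≤ c → c * (SX + SY) ≤ c * c * m + T
  mixed-sum-≤ c r≤c s≤c =
    subst₂ _≤_ (sym (mixed-lhs c)) (mixed-rhs c) (sum-on-mono mid? (mixed-pointwise c r≤c s≤c))

  mixed-sum-tight : ∀ c → r ≤ c → s ≤ c → c * (SX + SY) ≡ c * c * m + T →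
                    ∀ k → InMid r s k → x k ≡ c ⊎ y k ≡ c
  mixed-sum-tight c r≤c s≤c sum≡ k k∈ =
    mixed-tight c (x k) (y k) (≤-trans (x≤r k) r≤c) (≤-trans (y≤s k) s≤c) (pointwise k k∈)
    where
    pointwise = sum-on-tight mid? (mixed-pointwise c r≤c s≤c)
                  (trans (sym (mixed-lhs c)) (trans sum≡ (sym (mixed-rhs c))))

  private
    SZ≤ : ∀ c d → c * d ≡ r * s → SZ ≤ c * d
    SZ≤ c d cd≡rs = subst (SZ ≤_) (sym cd≡rs) (corner-≤ a a≤1)

    T≤ : ∀ c d → c * d ≡ r * s → T ≤ c * d
    T≤ c d cd≡rs = subst₂ _≤_ (sym T≡corner) (sym cd≡rs) (corner-≤ Q Q≤1)

  bounded-by : ∀ c d → r ≤ c → s ≤ c → c * d ≡ r * s → f A ≤ suc c * (m + d)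
  bounded-by c d r≤c s≤c cd≡rs = subst (_≤ suc c * (m + d)) (sym f-decomposition)
    (budget c d m SX SY SZ T (SZ≤ c d cd≡rs) (mixed-sum-≤ c r≤c s≤c) (T≤ c d cd≡rs)
      (sum-on-bound mid? c (λ k _ → ≤-trans (x≤r k) r≤c))
      (sum-on-bound mid? c (λ k _ → ≤-trans (y≤s k) s≤c)))

  r-split : r + (m + s) ≡ n
  r-split = trans (sym (+-assoc r m s)) block-sizes

  s-split : s + (m + r) ≡ n
  s-split = trans (regroup s m r) block-sizes
    where
    regroup : ∀ s m r → s + (m + r) ≡ r + m + s
    regroup = solve-∀

  -- The bound: with c = max(r, s), f(A) ≤ (c + 1)(n − c) ≤ γ(n).
  f-bound : f A ≤ γ n
  f-bound with s ≤? r
  ... | yes s≤r = ≤-trans (bounded-by r s ≤-refl s≤r refl) (γ-bound r (m + s) r-split)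
  ... | no s≰r =
    ≤-trans (bounded-by s r (<⇒≤ (≰⇒> s≰r)) ≤-refl (*-comm s r)) (γ-bound s (m + r) s-split)

  Z-full : SZ ≡ r * s → ∀ i j → InFirst r i → InLast s j → A i j ≡ true
  Z-full SZ≡ i j i∈ j∈ = val-true (corner-full a a≤1 SZ≡ i j i∈ j∈)

  Q-full : T ≡ r * s → ∀ i j → InFirst r i → InLast s j → Q i j ≡ 1
  Q-full T≡ = corner-full Q Q≤1 (trans (sym T≡corner) T≡)

  Q-through-X : ∀ i j → (∀ k → InMid r s k → A i k ≡ true) → Q i j ≡ κ j
  Q-through-X i j row-full =
    sum-on-cong mid? (λ k k∈ → trans (cong (λ t → val t * a k j) (row-full k k∈)) (*-identityˡ (a k j)))

  Q-through-Y : ∀ i j → (∀ k → InMid r s k → A k j ≡ true) → Q i j ≡ ρ i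
  Q-through-Y i j column-full =
    sum-on-cong mid? (λ k k∈ → trans (cong (λ t → a i k * val t) (column-full k k∈)) (*-identityʳ (a i k)))

  condA-from : SizeCond n r → 1 ≤ r → SZ ≡ r * s → T ≡ r * s → (∀ k → InMid r s k → x k ≡ r) →
               CondA n r s A
  condA-from size 1≤r SZ≡ T≡ x≡r = size , X-ones , Z-full SZ≡ , Y-columns
    where
    X-ones : ∀ i k → InFirst r i → InMid r s k → A i k ≡ true
    X-ones i k i∈ k∈ = X-column-full k (x≡r k k∈) i i∈
    Y-columns : ∀ j → InLast s j → ExactlyOne (λ i → InMid r s i × A i j ≡ true)
    Y-columns j j∈ with nonempty first? (subst (1 ≤_) (sym count-first) 1≤r)
    ... | i₀ , i₀∈ = Equivalence.to (sum-on-one-iff mid? (λ i → A i j))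
          (trans (sym (Q-through-X i₀ j (λ k k∈ → X-ones i₀ k i₀∈ k∈))) (Q-full T≡ i₀ j i₀∈ j∈))

  condB-from : SizeCond n s → 1 ≤ s → SZ ≡ r * s → T ≡ r * s → (∀ k → InMid r s k → y k ≡ s) →
               CondB n r s A
  condB-from size 1≤s SZ≡ T≡ y≡s = size , Y-ones , Z-full SZ≡ , X-rows
    where
    Y-ones : ∀ k j → InMid r s k → InLast s j → A k j ≡ true
    Y-ones k j k∈ j∈ = Y-row-full k (y≡s k k∈) j j∈
    X-rows : ∀ i → InFirst r i → ExactlyOne (λ j → InMid r s j × A i j ≡ true)
    X-rows i i∈ with nonempty last? (subst (1 ≤_) (sym count-last) 1≤s)
    ... | j₀ , j₀∈ = Equivalence.to (sum-on-one-iff mid? (A i))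
          (trans (sym (Q-through-Y i j₀ (λ k k∈ → Y-ones k j₀ k∈ j₀∈))) (Q-full T≡ i j₀ i∈ j₀∈))

  -- When r = s, a middle k₁ with a non-full X-column and a middle k₂ with a non-full
  -- Y-row cannot coexist: for a zero A(i₀,k₁) and a zero A(k₂,j₀), the path i₀ → j₀
  -- given by Q-full runs through a third middle index k₃, while the size condition
  -- leaves room for only two.
  no-mixed-middle : r ≡ s → SizeCond n r → T ≡ r * s → ∀ {k₁ k₂} → InMid r s k₁ → InMid r s k₂ →
                    x k₁ ≢ r → x k₂ ≡ r → y k₂ ≢ s → ⊥
  no-mixed-middle r≡s size T≡ {k₁} {k₂} k₁∈ k₂∈ x₁≢r x₂≡r y₂≢s = <⇒≱ three≤m m≤2
    where
    m≤2 : m ≤ 2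
    m≤2 = sizeCond-middle m size (trans (cong (r + m +_) r≡s) block-sizes)
    column-gap : ∃ λ i → InFirst r i × a i k₁ ≢ 1
    column-gap = sum-on-≢ first? (λ x₁≡ → x₁≢r (trans x₁≡ (first-ones (λ _ _ → refl))))
    row-gap : ∃ λ j → InLast s j × a k₂ j ≢ 1
    row-gap = sum-on-≢ last? (λ y₂≡ → y₂≢s (trans y₂≡ (last-ones (λ _ _ → refl))))
    i₀ = proj₁ column-gap
    j₀ = proj₁ row-gap
    Q₀≡1 : Q i₀ j₀ ≡ 1
    Q₀≡1 = Q-full T≡ i₀ j₀ (proj₁ (proj₂ column-gap)) (proj₁ (proj₂ row-gap))
    path : ∃ λ k → InMid r s k × a i₀ k * a k j₀ ≢ 0
    path = sum-on-≢ mid? (λ Q≡ → 1+n≢0 (trans (sym Q₀≡1) (trans Q≡ (sum-on-zero mid? (λ _ _ → refl)))))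
    k₃ = proj₁ path
    edges = val*val≢0 (A i₀ k₃) (A k₃ j₀) (proj₂ (proj₂ path))
    k₁≢k₂ : k₁ ≢ k₂
    k₁≢k₂ refl = x₁≢r x₂≡r
    k₁≢k₃ : k₁ ≢ k₃
    k₁≢k₃ k₁≡k₃ = proj₂ (proj₂ column-gap) (subst (λ k → a i₀ k ≡ 1) (sym k₁≡k₃) (proj₁ edges))
    k₂≢k₃ : k₂ ≢ k₃
    k₂≢k₃ k₂≡k₃ = proj₂ (proj₂ row-gap) (subst (λ k → a k j₀ ≡ 1) (sym k₂≡k₃) (proj₂ edges))
    three≤m : 3 ≤ m
    three≤m = subst (_≤ m) ones (sum-triple (𝟙 ∘ mid?) k₁≢k₂ k₁≢k₃ k₂≢k₃)
      where
      ones : 𝟙 (mid? k₁) + 𝟙 (mid? k₂) + 𝟙 (mid? k₃) ≡ 3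
      ones = trans (cong₂ (λ u v → u + v + 𝟙 (mid? k₃)) (𝟙-yes k₁∈ (mid? k₁)) (𝟙-yes k₂∈ (mid? k₂)))
                   (cong (2 +_) (𝟙-yes (proj₁ (proj₂ path)) (mid? k₃)))

  full-X-or-full-Y : r ≡ s → SizeCond n r → T ≡ r * s → (∀ k → InMid r s k → x k ≡ r ⊎ y k ≡ r) →
                     (∀ k → InMid r s k → x k ≡ r) ⊎ (∀ k → InMid r s k → y k ≡ s)
  full-X-or-full-Y r≡s size T≡ full-line with sum-on-all-or-gap mid? r (λ k _ → x≤r k)
  ... | inj₁ all-x = inj₁ all-x
  ... | inj₂ (k₁ , k₁∈ , x₁≢r) with sum-on-all-or-gap mid? s (λ k _ → y≤s k)
  ...   | inj₁ all-y = inj₂ all-y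
  ...   | inj₂ (k₂ , k₂∈ , y₂≢s) = ⊥-elim (no-mixed-middle r≡s size T≡ k₁∈ k₂∈ x₁≢r x₂≡r y₂≢s)
    where
    x₂≡r : x k₂ ≡ r
    x₂≡r with full-line k₂ k₂∈
    ... | inj₁ x₂≡r = x₂≡r
    ... | inj₂ y₂≡r = contradiction (trans y₂≡r r≡s) y₂≢s

  record EqualityFacts (c : ℕ) : Set where
    field
      size : SizeCond n c
      1≤c : 1 ≤ c
      SZ≡rs : SZ ≡ r * s
      T≡rs : T ≡ r * s
      full-line : ∀ k → InMid r s k → x k ≡ c ⊎ y k ≡ c

  equality-facts : ∀ c d → r ≤ c → s ≤ c → c * d ≡ r * s → c + (m + d) ≡ n → 3 ≤ n → f A ≡ γ n →
                   EqualityFacts c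
  equality-facts c d r≤c s≤c cd≡rs c-split 3≤n f≡γ = record
    { size = size
    ; 1≤c = 1≤c
    ; SZ≡rs = trans (proj₁ tight) cd≡rs
    ; T≡rs = trans (proj₂ (proj₂ tight)) cd≡rs
    ; full-line = mixed-sum-tight c r≤c s≤c (proj₁ (proj₂ tight))
    }
    where
    squeeze = ≤-squeeze (bounded-by c d r≤c s≤c cd≡rs) (γ-bound c (m + d) c-split) f≡γ
    size : SizeCond n c
    size = Equivalence.to (γ-tight c (m + d) c-split) (proj₂ squeeze)
    1≤c : 1 ≤ c
    1≤c = sizeCond-pos 3≤n size
    tight = budget-tight c d m SX SY SZ T 1≤c (SZ≤ c d cd≡rs) (mixed-sum-≤ c r≤c s≤c) (T≤ c d cd≡rs)
                         (trans (sym f-decomposition) (proj₁ squeeze))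

  only-X-column : ∀ {c k} → s < c → x k ≡ c ⊎ y k ≡ c → x k ≡ c
  only-X-column _ (inj₁ xₖ≡c) = xₖ≡c
  only-X-column {k = k} s<c (inj₂ yₖ≡c) = contradiction (subst (_≤ s) yₖ≡c (y≤s k)) (<⇒≱ s<c)

  only-Y-row : ∀ {c k} → r < c → x k ≡ c ⊎ y k ≡ c → y k ≡ c
  only-Y-row {k = k} r<c (inj₁ xₖ≡c) = contradiction (subst (_≤ r) xₖ≡c (x≤r k)) (<⇒≱ r<c)
  only-Y-row _ (inj₂ yₖ≡c) = yₖ≡c

  forced-when-s<r : 3 ≤ n → s < r → f A ≡ γ n → CondA n r s A
  forced-when-s<r 3≤n s<r f≡γ = condA-from size 1≤c SZ≡rs T≡rs (λ k k∈ → only-X-column s<r (full-line k k∈))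
    where open EqualityFacts (equality-facts r s ≤-refl (<⇒≤ s<r) refl r-split 3≤n f≡γ)

  forced-when-r<s : 3 ≤ n → r < s → f A ≡ γ n → CondB n r s A
  forced-when-r<s 3≤n r<s f≡γ = condB-from size 1≤c SZ≡rs T≡rs (λ k k∈ → only-Y-row r<s (full-line k k∈))
    where open EqualityFacts (equality-facts s r (<⇒≤ r<s) ≤-refl (*-comm s r) s-split 3≤n f≡γ)

  forced-when-r≡s : 3 ≤ n → r ≡ s → f A ≡ γ n → CondA n r s A ⊎ CondB n r s A
  forced-when-r≡s 3≤n r≡s f≡γ = conclude (full-X-or-full-Y r≡s size T≡rs full-line)
    where
    open EqualityFacts (equality-facts r s ≤-refl (≤-reflexive (sym r≡s)) refl r-split 3≤n f≡γ)
    conclude : (∀ k → InMid r s k → x k ≡ r) ⊎ (∀ k → InMid r s k → y k ≡ s) →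
               CondA n r s A ⊎ CondB n r s A
    conclude (inj₁ all-x) = inj₁ (condA-from size 1≤c SZ≡rs T≡rs all-x)
    conclude (inj₂ all-y) =
      inj₂ (condB-from (subst (SizeCond n) r≡s size) (subst (1 ≤_) r≡s 1≤c) SZ≡rs T≡rs all-y)

  equality-forces : 3 ≤ n → f A ≡ γ n → CondA n r s A ⊎ CondB n r s A
  equality-forces 3≤n f≡γ with <-cmp r s
  ... | tri< r<s _ _ = inj₂ (forced-when-r<s 3≤n r<s f≡γ)
  ... | tri≈ _ r≡s _ = forced-when-r≡s 3≤n r≡s f≡γ
  ... | tri> _ _ s<r = inj₁ (forced-when-s<r 3≤n s<r f≡γ)

  SZ-full : (∀ i j → InFirst r i → InLast s j → A i j ≡ true) → SZ ≡ r * s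
  SZ-full Z-ones = first-full s (λ i i∈ → last-ones (λ j j∈ → cong val (Z-ones i j i∈ j∈)))

  condA-attains : CondA n r s A → f A ≡ γ n
  condA-attains (size , X-ones , Z-ones , Y-columns) = begin
    f A                        ≡⟨ f-decomposition ⟩
    SX + SZ + (m + SY)         ≡⟨ cong₂ (λ u v → u + v + (m + SY)) SX≡ (SZ-full Z-ones) ⟩
    m * r + r * s + (m + SY)   ≡⟨ cong (λ v → m * r + r * s + (m + v)) SY≡ ⟩
    m * r + r * s + (m + s)    ≡⟨ regroup m r s ⟩
    suc r * (m + s)            ≡⟨ Equivalence.from (γ-tight r (m + s) r-split) size ⟩
    γ n                        ∎
    where
    open ≡-Reasoning
    SX≡ : SX ≡ m * r
    SX≡ = sum-on-full mid? r (λ k k∈ → first-ones (λ i i∈ → cong val (X-ones i k i∈ k∈)))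
    SY≡ : SY ≡ s
    SY≡ = trans (sum-on-swap mid? last? a)
                (last-ones (λ j j∈ → Equivalence.from (sum-on-one-iff mid? (λ i → A i j)) (Y-columns j j∈)))
    regroup : ∀ m r s → m * r + r * s + (m + s) ≡ suc r * (m + s)
    regroup = solve-∀

  condB-attains : CondB n r s A → f A ≡ γ n
  condB-attains (size , Y-ones , Z-ones , X-rows) = begin
    f A                        ≡⟨ f-decomposition ⟩
    SX + SZ + (m + SY)         ≡⟨ cong₂ (λ u v → u + v + (m + SY)) SX≡ (SZ-full Z-ones) ⟩
    r + r * s + (m + SY)       ≡⟨ cong (λ v → r + r * s + (m + v)) SY≡ ⟩
    r + r * s + (m + m * s)    ≡⟨ regroup m r s ⟩
    suc s * (m + r)            ≡⟨ Equivalence.from (γ-tight s (m + r) s-split) size ⟩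
    γ n                        ∎
    where
    open ≡-Reasoning
    SX≡ : SX ≡ r
    SX≡ = trans (sum-on-swap mid? first? (λ k i → a i k))
                (first-ones (λ i i∈ → Equivalence.from (sum-on-one-iff mid? (A i)) (X-rows i i∈)))
    SY≡ : SY ≡ m * s
    SY≡ = sum-on-full mid? s (λ k k∈ → last-ones (λ j j∈ → cong val (Y-ones k j k∈ j∈)))
    regroup : ∀ m r s → r + r * s + (m + m * s) ≡ suc s * (m + r)
    regroup = solve-∀

lemma3p2 : (n : ℕ) → 3 ≤ n → (r s : ℕ) → (A : Matrix n) →
           BlockForm n r s A →
           (∀ i j → sq A i j ≤ 1) →
           f A ≤ γ n × (f A ≡ γ n ⇔ (CondA n r s A ⊎ CondB n r s A))
lemma3p2 n 3≤n r s A (r+s≤n , first-column-zero , last-row-zero , P-rows , _) square-01 =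
  f-bound , mk⇔ (equality-forces 3≤n) [ condA-attains , condB-attains ]
  where open Analysis r+s≤n first-column-zero last-row-zero P-rows square-01
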